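{- Let $\Sigma$ be a counting signature with exactly $m$ counting predicates, let $Y$ be a non-negative integer, let $\mathfrak{A}$ be a $Y$-branching structure interpreting $\Sigma$, and let $\pi,\pi'$ be 1-types over $\Sigma$ (not necessarily distinct). If $\pi$ and $\pi'$ form a noisy pair in $\mathfrak{A}$, then either at most $(mY+1)^2$ elements of $A$ have 1-type $\pi$, or at most $(mY+1)^2$ elements of $A$ have 1-type $\pi'$.
   Context: Structures are finite or countably infinite and interpret a finite signature of unary and binary predicates (no constants, no function symbols); equality is a logical constant. A counting signature is such a signature with a distinguished subset of binary predicates, the counting predicates. A 1-type is a maximal consistent set of equality-free literals in the variable $x$ only; a 2-type is a maximal consistent set of equality-free literals in the variables $x,y$. For a 2-type $\tau$, $\tau^{ -1}$ is obtained by swapping $x,y$. $\mathrm{tp}^{\mathfrak A}[a]$ is the 1-type of $a$; for distinct $a,b$, $\mathrm{tp}^{\mathfrak A}[a,b]$ is the 2-type of $(a,b)$. A 2-type $\tau$ is a message-type if $f(x,y)\in\tau$ for some counting predicate $f$, and is silent if neither $\tau$ nor $\tau^{ -1}$ is a message-type. $\mathfrak A$ is $Y$-branching if for every $a\in A$ and counting predicate $f$, $|\{a'\in A: a'\neq a,\ \mathfrak A\models f[a,a']\}|\le Y$. 1-types $\pi,\pi'$ form a noisy pair in $\mathfrak A$ if there do not exist distinct $a,a'\in A$ with $\mathrm{tp}^{\mathfrak A}[a]=\pi$, $\mathrm{tp}^{\mathfrak A}[a']=\pi'$ and $\mathrm{tp}^{\mathfrak A}[a,a']$ silent. -}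

module Defs where

open import Data.Nat using (ℕ; suc; _+_; _*_; _^_)
open import Data.Fin using (Fin)
open import Data.Bool using (Bool; true; false)
open import Data.Vec using (Vec; tabulate; lookup)
open import Data.Sum using (_⊎_; inj₁; inj₂)
open import Data.Product using (Σ; ∃; _×_; _,_)
open import Data.Empty using (⊥)
open import Relation.Nullary using (¬_)
open import Relation.Binary.PropositionalEquality using (_≡_; _≢_)
open import Function.Definitions using (Injective)

-- A counting signature: nU unary predicates, and binary predicates indexed by
-- Fin m ⊎ Fin k; the inj₁-indexed ones (exactly m of them) are the counting
-- predicates, the inj₂-indexed ones are the non-counting binary predicates.
record Signature : Set where
  field
    nU : ℕ
    m  : ℕ
    k  : ℕ

  Bin : Set
  Bin = Fin m ⊎ Fin k

  nB : ℕ
  nB = m + k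

open Signature

binIndex : (Σ' : Signature) → Bin Σ' → Fin (nB Σ')
binIndex Σ' (inj₁ f) = Data.Fin._↑ˡ_ f (k Σ')
binIndex Σ' (inj₂ r) = Data.Fin._↑ʳ_ (m Σ') r

-- A structure interpreting Σ with a finite or countably infinite domain
-- (i.e. the domain injects into ℕ). Predicates are interpreted classically
-- as Boolean-valued relations.
record Structure (Σ' : Signature) : Set₁ where
  field
    Carrier : Set
    enc     : Carrier → ℕ
    enc-inj : Injective _≡_ _≡_ enc
    unary   : Fin (nU Σ') → Carrier → Bool
    binary  : Bin Σ' → Carrier → Carrier → Bool

open Structure

-- 1-types: truth values of the unary literals P(x) and of the binary literals R(x,x).
-- (Every such valuation is a maximal consistent set of equality-free literals in x.)
OneType : Signature → Set
OneType Σ' = Vec Bool (nU Σ') × Vec Bool (nB Σ')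

record TwoType (Σ' : Signature) : Set where
  constructor twoType
  field
    tyX : OneType Σ'
    tyY : OneType Σ'
    xy  : Vec Bool (nB Σ')
    yx  : Vec Bool (nB Σ')

open TwoType

_⁻¹ : ∀ {Σ'} → TwoType Σ' → TwoType Σ'
twoType a b c d ⁻¹ = twoType b a d c

module _ {Σ' : Signature} (𝔄 : Structure Σ') where

  binAt : Fin (nB Σ') → Carrier 𝔄 → Carrier 𝔄 → Bool
  binAt i a b = binary 𝔄 (Data.Sum.[ inj₁ , inj₂ ]′ (Data.Fin.splitAt (m Σ') i)) a b

  tp : Carrier 𝔄 → OneType Σ'
  tp a = tabulate (λ i → unary 𝔄 i a) , tabulate (λ i → binAt i a a)

  tp₂ : Carrier 𝔄 → Carrier 𝔄 → TwoType Σ'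
  tp₂ a b = twoType (tp a) (tp b) (tabulate (λ i → binAt i a b)) (tabulate (λ i → binAt i b a))

IsMessageType : ∀ {Σ'} → TwoType Σ' → Set
IsMessageType {Σ'} τ = ∃ λ (f : Fin (m Σ')) → lookup (xy τ) (binIndex Σ' (inj₁ f)) ≡ true

Silent : ∀ {Σ'} → TwoType Σ' → Set
Silent τ = ¬ IsMessageType τ × ¬ IsMessageType (τ ⁻¹)

AtMost : {X : Set} → ℕ → (X → Set) → Set
AtMost {X} N P = (g : Fin (suc N) → X) → Injective _≡_ _≡_ g → ¬ (∀ i → P (g i))

module _ {Σ' : Signature} (𝔄 : Structure Σ') where

  Branching : ℕ → Set
  Branching Y = ∀ (a : Carrier 𝔄) (f : Fin (m Σ')) →
    AtMost Y (λ a' → a' ≢ a × binary 𝔄 (inj₁ f) a a' ≡ true)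

  NoisyPair : OneType Σ' → OneType Σ' → Set
  NoisyPair π π' = ¬ (Σ (Carrier 𝔄) λ a → Σ (Carrier 𝔄) λ a' →
    a ≢ a' × tp 𝔄 a ≡ π × tp 𝔄 a' ≡ π' × Silent (tp₂ 𝔄 a a'))

-- Fix D + 1 distinct elements a₀, …, a_D of type π, where D = mY. Every element b of type π'
-- lies in the closed out-neighbourhood of some aᵢ (b = aᵢ, or aᵢ sends b a message): otherwise,
-- since the pair is noisy, b would send a message to each of the D + 1 elements aᵢ, while
-- Y-branching allows b at most mY message targets. A closed out-neighbourhood has at most
-- 1 + mY elements, so at most (D + 1)(1 + mY) = (mY + 1)² elements have type π'.
module Submission where

open import Defs
open import Data.Nat using (ℕ; suc; _+_; _*_; _^_)
open import Data.Sum using (_⊎_)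
open import Relation.Nullary using (¬_)
open import Relation.Binary.PropositionalEquality using (_≡_)

open import Data.Nat using (zero; _≤_; z≤n; s≤s)
open import Data.Nat.Properties using (+-suc; +-comm; *-identityʳ; n≮n; m≤m*n; n≤1+n; module ≤-Reasoning)
import Data.Nat.Properties as ℕ
open import Data.Fin using (Fin; zero; suc; inject≤; _↑ˡ_)
open import Data.Fin.Properties using (0≢1+n; suc-injective; inject≤-injective; splitAt-↑ˡ; any?)
open import Data.Vec using (lookup; tabulate)
open import Data.Vec.Properties using (lookup∘tabulate)
open import Data.Vec.Functional using (_∷_)
open import Data.Bool using (true)
import Data.Bool as Bool
open import Data.Sum using (inj₁; inj₂; [_,_]′)
import Data.Sum as Sum
open import Data.Product using (∃; _×_; _,_; proj₁; proj₂)
open import Data.Empty using (⊥-elim)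
open import Function using (_∘_)
open import Function.Definitions using (Injective)
open import Level using (0ℓ)
open import Relation.Unary using (Pred; _∈_; _∉_; _⊆_; _∪_; _∩_; ∁; ｛_｝; ⋃)
open import Relation.Binary.Definitions using (DecidableEquality)
open import Relation.Binary.PropositionalEquality
  using (_≢_; refl; sym; trans; cong; subst; module ≡-Reasoning)
open import Relation.Nullary using (Dec; yes; no)
open import Relation.Nullary.Decidable using (map′; decidable-stable; ¬?; _×-dec_; _⊎-dec_)

module _ {X : Set} where

  AtMost-mono : ∀ {N} {P Q : Pred X 0ℓ} → P ⊆ Q → AtMost N Q → AtMost N P
  AtMost-mono P⊆Q atMost g g-inj g∈P = atMost g g-inj (P⊆Q ∘ g∈P)

  AtMost-∩ : ∀ {N} {P R : Pred X 0ℓ} → AtMost N P → AtMost N (P ∩ R)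
  AtMost-∩ {P = P} {R} = AtMost-mono {P = P ∩ R} {P} proj₁

  AtMost-zero : ∀ {P : Pred X 0ℓ} {a} → AtMost 0 P → a ∉ P
  AtMost-zero atMost a∈P = atMost (λ _ → _) (λ { {zero} {zero} _ → refl }) (λ _ → a∈P)

  AtMost-singleton : ∀ (a : X) → AtMost 1 ｛ a ｝
  AtMost-singleton a g g-inj a≡g = 0≢1+n (g-inj (trans (sym (a≡g zero)) (a≡g (suc zero))))

  AtMost-remove : ∀ {N} {P : Pred X 0ℓ} {a} → AtMost (suc N) P → a ∈ P → AtMost N (P ∩ ∁ ｛ a ｝)
  AtMost-remove {P = P} {a} atMost a∈P g g-inj g∈ = atMost (a ∷ g) cons-inj cons∈P
    where
    cons-inj : Injective _≡_ _≡_ (a ∷ g)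
    cons-inj {zero}  {zero}  _ = refl
    cons-inj {zero}  {suc j} e = ⊥-elim (proj₂ (g∈ j) e)
    cons-inj {suc i} {zero}  e = ⊥-elim (proj₂ (g∈ i) (sym e))
    cons-inj {suc i} {suc j} e = cong suc (g-inj e)
    cons∈P : ∀ i → (a ∷ g) i ∈ P
    cons∈P zero    = a∈P
    cons∈P (suc i) = proj₁ (g∈ i)

  tail-remove : ∀ {n} {P Q : Pred X 0ℓ} (g : Fin (suc n) → X) → Injective _≡_ _≡_ g →
    (∀ i → g i ∈ P ∪ Q) → ∀ i → g (suc i) ∈ (P ∩ ∁ ｛ g zero ｝) ∪ (Q ∩ ∁ ｛ g zero ｝)
  tail-remove g g-inj g∈ i = Sum.map (_, 0≢1+n ∘ g-inj) (_, 0≢1+n ∘ g-inj) (g∈ (suc i))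

  -- g zero uses up one of the c + d slots, on the side of P or of Q it lies in.
  length≤-∪ : ∀ {c d n} {P Q : Pred X 0ℓ} → AtMost c P → AtMost d Q →
    (g : Fin n → X) → Injective _≡_ _≡_ g → (∀ i → g i ∈ P ∪ Q) → n ≤ c + d
  length≤-∪ {n = zero} _ _ _ _ _ = z≤n
  length≤-∪ {n = suc n} p q g g-inj g∈ with g∈ zero
  length≤-∪ {zero}  {_}     {suc _} {P} p q g g-inj g∈ | inj₁ P₀ = ⊥-elim (AtMost-zero {P = P} p P₀)
  length≤-∪ {suc c} {_}     {suc n} {P} {Q} p q g g-inj g∈ | inj₁ P₀ =
    s≤s (length≤-∪ {P = P ∩ ∁ ｛ g zero ｝} {Q ∩ ∁ ｛ g zero ｝}
                   (AtMost-remove {P = P} p P₀) (AtMost-∩ {P = Q} {∁ ｛ g zero ｝} q)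
                   (g ∘ suc) (suc-injective ∘ g-inj) (tail-remove {P = P} {Q} g g-inj g∈))
  length≤-∪ {_}     {zero}  {suc _} {Q = Q} p q g g-inj g∈ | inj₂ Q₀ = ⊥-elim (AtMost-zero {P = Q} q Q₀)
  length≤-∪ {c}     {suc d} {suc n} {P} {Q} p q g g-inj g∈ | inj₂ Q₀ =
    subst (suc n ≤_) (sym (+-suc c d))
      (s≤s (length≤-∪ {P = P ∩ ∁ ｛ g zero ｝} {Q ∩ ∁ ｛ g zero ｝}
                      (AtMost-∩ {P = P} {∁ ｛ g zero ｝} p) (AtMost-remove {P = Q} q Q₀)
                      (g ∘ suc) (suc-injective ∘ g-inj) (tail-remove {P = P} {Q} g g-inj g∈)))

  AtMost-∪ : ∀ {c d} {P Q : Pred X 0ℓ} → AtMost c P → AtMost d Q → AtMost (c + d) (P ∪ Q)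
  AtMost-∪ {P = P} {Q} p q g g-inj g∈ = n≮n _ (length≤-∪ {P = P} {Q} p q g g-inj g∈)

  AtMost-⋃ : ∀ {L c} {P : Fin L → Pred X 0ℓ} → (∀ i → AtMost c (P i)) → AtMost (L * c) (⋃ (Fin L) P)
  AtMost-⋃ {zero} _ g _ g∈ with g∈ zero
  ... | () , _
  AtMost-⋃ {suc L} {P = P} p =
    AtMost-mono {P = ⋃ (Fin (suc L)) P} split
      (AtMost-∪ {P = P zero} {⋃ (Fin L) (P ∘ suc)} (p zero) (AtMost-⋃ {P = P ∘ suc} (p ∘ suc)))
    where
    split : ⋃ (Fin (suc L)) P ⊆ P zero ∪ ⋃ (Fin L) (P ∘ suc)
    split (zero  , x∈P) = inj₁ x∈P
    split (suc i , x∈P) = inj₂ (i , x∈P)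

module _ {Σ' : Signature} (𝔄 : Structure Σ') where
  open Signature Σ'
  open Structure 𝔄

  _≟_ : DecidableEquality Carrier
  x ≟ y = map′ enc-inj (cong enc) (enc x ℕ.≟ enc y)

  Message : Carrier → Carrier → Set
  Message a b = ∃ λ f → binary (inj₁ f) a b ≡ true

  message? : ∀ a b → Dec (Message a b)
  message? a b = any? (λ f → binary (inj₁ f) a b Bool.≟ true)

  isMessageType⇒Message : ∀ {a b} → IsMessageType (tp₂ 𝔄 a b) → Message a b
  isMessageType⇒Message {a} {b} (f , f∈τ) = f , (begin
    binary (inj₁ f) a b
      ≡⟨ cong (λ r → binary ([ inj₁ , inj₂ ]′ r) a b) (splitAt-↑ˡ m f k) ⟨
    binAt 𝔄 (f ↑ˡ k) a b
      ≡⟨ lookup∘tabulate (λ i → binAt 𝔄 i a b) (f ↑ˡ k) ⟨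
    lookup (tabulate (λ i → binAt 𝔄 i a b)) (f ↑ˡ k)
      ≡⟨ f∈τ ⟩
    true ∎)
    where open ≡-Reasoning

  silent : ∀ {a b} → ¬ Message a b → ¬ Message b a → Silent (tp₂ 𝔄 a b)
  silent ¬a→b ¬b→a = ¬a→b ∘ isMessageType⇒Message , ¬b→a ∘ isMessageType⇒Message

  noisy⇒message : ∀ {π π' a b} → NoisyPair 𝔄 π π' → a ≢ b → tp 𝔄 a ≡ π → tp 𝔄 b ≡ π' →
    ¬ Message a b → Message b a
  noisy⇒message {a = a} {b} noisy a≢b a∈π b∈π' ¬a→b =
    decidable-stable (message? b a) (λ ¬b→a → noisy (a , b , a≢b , a∈π , b∈π' , silent ¬a→b ¬b→a))

  MessageTarget : Carrier → Fin m → Pred Carrier 0ℓ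
  MessageTarget a f x = x ≢ a × binary (inj₁ f) a x ≡ true

  OutNeighbourhood : Carrier → Pred Carrier 0ℓ
  OutNeighbourhood a = ⋃ (Fin m) (MessageTarget a)

  ClosedOutNeighbourhood : Carrier → Pred Carrier 0ℓ
  ClosedOutNeighbourhood a = ｛ a ｝ ∪ OutNeighbourhood a

  closedOutNeighbourhood? : ∀ a x → Dec (x ∈ ClosedOutNeighbourhood a)
  closedOutNeighbourhood? a x =
    (a ≟ x) ⊎-dec any? (λ f → ¬? (x ≟ a) ×-dec (binary (inj₁ f) a x Bool.≟ true))

  module _ {Y} (branching : Branching 𝔄 Y) where

    AtMost-closedOutNeighbourhood : ∀ a → AtMost (1 + m * Y) (ClosedOutNeighbourhood a)
    AtMost-closedOutNeighbourhood a =
      AtMost-∪ {P = ｛ a ｝} {OutNeighbourhood a}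
        (AtMost-singleton a) (AtMost-⋃ {P = MessageTarget a} (branching a))

    module _ {π π'} (noisy : NoisyPair 𝔄 π π') (a : Fin (suc (m * Y)) → Carrier)
             (a-inj : Injective _≡_ _≡_ a) (a∈π : ∀ i → tp 𝔄 (a i) ≡ π) where

      -- Being covered is decidable, which is what lets us argue by cases on an uncovered b.
      closedOutNeighbourhoods-cover :
        (λ b → tp 𝔄 b ≡ π') ⊆ ⋃ (Fin (suc (m * Y))) (ClosedOutNeighbourhood ∘ a)
      closedOutNeighbourhoods-cover {b} b∈π' with any? (λ i → closedOutNeighbourhood? (a i) b)
      ... | yes covered = covered
      ... | no uncovered = ⊥-elim (AtMost-⋃ {P = MessageTarget b} (branching b) a a-inj replies)
        where
        replies : ∀ i → a i ∈ OutNeighbourhood b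
        replies i = let (f , b→aᵢ) = noisy⇒message noisy aᵢ≢b (a∈π i) b∈π' ¬aᵢ→b in f , aᵢ≢b , b→aᵢ
          where
          b∉ : b ∉ ClosedOutNeighbourhood (a i)
          b∉ = uncovered ∘ (i ,_)
          aᵢ≢b : a i ≢ b
          aᵢ≢b = b∉ ∘ inj₁
          ¬aᵢ→b : ¬ Message (a i) b
          ¬aᵢ→b (f , e) = b∉ (inj₂ (f , aᵢ≢b ∘ sym , e))

      noisyPair⇒AtMost : AtMost (suc (m * Y) * suc (m * Y)) (λ b → tp 𝔄 b ≡ π')
      noisyPair⇒AtMost = AtMost-mono {P = λ b → tp 𝔄 b ≡ π'} closedOutNeighbourhoods-cover
        (AtMost-⋃ {P = ClosedOutNeighbourhood ∘ a} (AtMost-closedOutNeighbourhood ∘ a))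

lemma12 : (Σ' : Signature) (Y : ℕ) (𝔄 : Structure Σ') → Branching 𝔄 Y →
    (π π' : OneType Σ') → NoisyPair 𝔄 π π' →
    ¬ ¬ (AtMost ((Signature.m Σ' * Y + 1) ^ 2) (λ a → tp 𝔄 a ≡ π)
         ⊎ AtMost ((Signature.m Σ' * Y + 1) ^ 2) (λ a → tp 𝔄 a ≡ π'))
lemma12 Σ' Y 𝔄 branching π π' noisy neither =
  neither (inj₁ λ g g-inj g∈π →
    neither (inj₂ (subst (λ N → AtMost N (λ b → tp 𝔄 b ≡ π')) (sym square)
      (noisyPair⇒AtMost 𝔄 branching noisy (g ∘ prefix)
         (inject≤-injective D<N D<N _ _ ∘ g-inj) (g∈π ∘ prefix)))))
  where
  D : ℕ
  D = Signature.m Σ' * Y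

  square : (D + 1) ^ 2 ≡ suc D * suc D
  square = begin
    (D + 1) ^ 2    ≡⟨ cong (_^ 2) (+-comm D 1) ⟩
    suc D ^ 2      ≡⟨ cong (suc D *_) (*-identityʳ (suc D)) ⟩
    suc D * suc D  ∎
    where open ≡-Reasoning

  D<N : suc D ≤ suc ((D + 1) ^ 2)
  D<N = begin
    suc D              ≤⟨ m≤m*n (suc D) (suc D) ⟩
    suc D * suc D      ≡⟨ square ⟨
    (D + 1) ^ 2        ≤⟨ n≤1+n _ ⟩
    suc ((D + 1) ^ 2)  ∎
    where open ≤-Reasoning

  prefix : Fin (suc D) → Fin (suc ((D + 1) ^ 2))
  prefix i = inject≤ i D<N
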